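{- $\mathsf{PA}^-_{\mathsf{jer}}$ proves: if $\mathsf{pow}_2(x)$ then $\mathsf{pow}_2^{\mathsf{tar}}(x)$.
   Context: $\mathsf{PA}^-_{\mathsf{jer}}$ is the theory in the language $0,1,+,\times,\leq$ with axioms: $x+0=x$; $x+y=y+x$; $(x+y)+z=x+(y+z)$; $x\cdot1=x$; $x\cdot y=y\cdot x$; $(x\cdot y)\cdot z=x\cdot(y\cdot z)$; $x\cdot(y+z)=x\cdot y+x\cdot z$; $x\leq y\vee y\leq x$; $(x\leq y\wedge y\leq z)\to x\leq z$; $x+1\not\leq x$; $y\leq x\to(y=x\vee y+1\leq x)$; $y\leq x\to y+z\leq x+z$; $y\leq x\to y\cdot z\leq x\cdot z$. $x\mid y$ means $\exists z\,z\cdot x=y$; $2:=1+1$, $3:=2+1$; $\mathsf{pow}_2(x)$ means $\forall y\,(y\mid x\to(y=1\vee 2\mid y))$; $\mathsf{pow}_2^{\mathsf{tar}}(x)$ means $\forall y\,\forall z\,x\neq(2\cdot y+3)\cdot z$. -}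

module Defs where

open import Level using (Level; _⊔_; suc)
open import Data.Product using (Σ; ∃; _×_; _,_)
open import Data.Sum using (_⊎_)
open import Relation.Nullary using (¬_)
open import Relation.Binary.PropositionalEquality using (_≡_; _≢_)

-- A model (structure) of PA⁻_jer in the language 0,1,+,×,≤.
-- Equality of the first-order language is interpreted as propositional equality.
record PAjer (a ℓ : Level) : Set (suc (a ⊔ ℓ)) where
  infixl 6 _+_
  infixl 7 _·_
  infix 4 _≤_
  field
    Carrier : Set a
    𝟘 𝟙 : Carrier
    _+_ _·_ : Carrier → Carrier → Carrier
    _≤_ : Carrier → Carrier → Set ℓ
    +-zero  : ∀ x → x + 𝟘 ≡ x
    +-comm  : ∀ x y → x + y ≡ y + x
    +-assoc : ∀ x y z → (x + y) + z ≡ x + (y + z)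
    ·-one   : ∀ x → x · 𝟙 ≡ x
    ·-comm  : ∀ x y → x · y ≡ y · x
    ·-assoc : ∀ x y z → (x · y) · z ≡ x · (y · z)
    distrib : ∀ x y z → x · (y + z) ≡ x · y + x · z
    ≤-total : ∀ x y → x ≤ y ⊎ y ≤ x
    ≤-trans : ∀ x y z → x ≤ y → y ≤ z → x ≤ z
    succ-≰  : ∀ x → ¬ (x + 𝟙 ≤ x)
    ≤-discr : ∀ x y → y ≤ x → (y ≡ x ⊎ y + 𝟙 ≤ x)
    ≤-+     : ∀ x y z → y ≤ x → y + z ≤ x + z
    ≤-·     : ∀ x y z → y ≤ x → y · z ≤ x · z

module Notions {a ℓ : Level} (M : PAjer a ℓ) where
  open PAjer M

  𝟚 𝟛 : Carrier
  𝟚 = 𝟙 + 𝟙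
  𝟛 = 𝟚 + 𝟙

  _∣_ : Carrier → Carrier → Set a
  x ∣ y = Σ Carrier (λ z → z · x ≡ y)

  pow₂ : Carrier → Set a
  pow₂ x = ∀ y → y ∣ x → (y ≡ 𝟙 ⊎ 𝟚 ∣ y)

  pow₂tar : Carrier → Set a
  pow₂tar x = ∀ y z → x ≢ (𝟚 · y + 𝟛) · z

{-# OPTIONS --safe #-}
module Submission where

open import Defs
open import Level using (Level)
open import Data.Product using (_,_)
open import Data.Sum using (_⊎_; inj₁; inj₂; [_,_])
open import Data.Empty using (⊥-elim)
open import Relation.Nullary using (¬_)
open import Relation.Binary.PropositionalEquality
  using (_≡_; _≢_; refl; sym; trans; cong; cong₂; subst; subst₂; module ≡-Reasoning)

-- The divisor 2y+3 of x would have to be 1 or even, and both are excluded by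
-- the discreteness of the order: 2y+3 = 1 cancels to (2y+1)+1 = 0, impossible
-- as 0 ≤ 2y+1; and w·2 = v·2+1 forces v < w, hence v·2+2 ≤ w·2 = v·2+1.

module Properties {a ℓ : Level} (M : PAjer a ℓ) where
  open PAjer M
  open Notions M
  open ≡-Reasoning

  infix 4 _<_
  _<_ : Carrier → Carrier → Set ℓ
  x < y = x + 𝟙 ≤ y

  ≤-reflexive : ∀ {x y} → x ≡ y → x ≤ y
  ≤-reflexive {x} refl with ≤-total x x
  ... | inj₁ x≤x = x≤x
  ... | inj₂ x≤x = x≤x

  <⇒≱ : ∀ {x y} → x < y → ¬ y ≤ x
  <⇒≱ {x} {y} x<y y≤x = succ-≰ x (≤-trans (x + 𝟙) y x x<y y≤x)

  <-irrefl : ∀ {x} → ¬ x < x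
  <-irrefl x<x = <⇒≱ x<x (≤-reflexive refl)

  <-cmp : ∀ x y → x < y ⊎ x ≡ y ⊎ y < x
  <-cmp x y with ≤-total x y
  ... | inj₁ x≤y with ≤-discr y x x≤y
  ...   | inj₁ x≡y = inj₂ (inj₁ x≡y)
  ...   | inj₂ x<y = inj₁ x<y
  <-cmp x y | inj₂ y≤x with ≤-discr x y y≤x
  ...   | inj₁ y≡x = inj₂ (inj₁ (sym y≡x))
  ...   | inj₂ y<x = inj₂ (inj₂ y<x)

  +-identityˡ : ∀ x → 𝟘 + x ≡ x
  +-identityˡ x = trans (+-comm 𝟘 x) (+-zero x)

  ·-identityˡ : ∀ x → 𝟙 · x ≡ x
  ·-identityˡ x = trans (·-comm 𝟙 x) (·-one x)

  ·-distribʳ : ∀ x y z → (y + z) · x ≡ y · x + z · x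
  ·-distribʳ x y z = begin
    (y + z) · x    ≡⟨ ·-comm (y + z) x ⟩
    x · (y + z)    ≡⟨ distrib x y z ⟩
    x · y + x · z  ≡⟨ cong₂ _+_ (·-comm x y) (·-comm x z) ⟩
    y · x + z · x  ∎

  +-monoˡ-< : ∀ {x y} z → x < y → x + z < y + z
  +-monoˡ-< {x} {y} z x<y = subst (_≤ y + z) shift (≤-+ y (x + 𝟙) z x<y)
    where
    shift : x + 𝟙 + z ≡ x + z + 𝟙
    shift = begin
      x + 𝟙 + z    ≡⟨ +-assoc x 𝟙 z ⟩
      x + (𝟙 + z)  ≡⟨ cong (x +_) (+-comm 𝟙 z) ⟩
      x + (z + 𝟙)  ≡⟨ +-assoc x z 𝟙 ⟨
      x + z + 𝟙    ∎

  +-cancelʳ-≡ : ∀ {x y} z → x + z ≡ y + z → x ≡ y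
  +-cancelʳ-≡ {x} {y} z eq with <-cmp x y
  ... | inj₁ x<y        = ⊥-elim (<⇒≱ (+-monoˡ-< z x<y) (≤-reflexive (sym eq)))
  ... | inj₂ (inj₁ x≡y) = x≡y
  ... | inj₂ (inj₂ y<x) = ⊥-elim (<⇒≱ (+-monoˡ-< z y<x) (≤-reflexive eq))

  ·-zeroˡ : ∀ x → 𝟘 · x ≡ 𝟘
  ·-zeroˡ x = +-cancelʳ-≡ (𝟘 · x) (begin
    𝟘 · x + 𝟘 · x  ≡⟨ ·-distribʳ x 𝟘 𝟘 ⟨
    (𝟘 + 𝟘) · x    ≡⟨ cong (_· x) (+-zero 𝟘) ⟩
    𝟘 · x          ≡⟨ +-identityˡ (𝟘 · x) ⟨
    𝟘 + 𝟘 · x      ∎)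

  0<1 : 𝟘 < 𝟙
  0<1 = ≤-reflexive (+-identityˡ 𝟙)

  0≤1 : 𝟘 ≤ 𝟙
  0≤1 with ≤-total 𝟘 𝟙
  ... | inj₁ 𝟘≤𝟙 = 𝟘≤𝟙
  ... | inj₂ 𝟙≤𝟘 = ⊥-elim (<⇒≱ 0<1 𝟙≤𝟘)

  0≤x : ∀ x → 𝟘 ≤ x
  0≤x x = subst₂ _≤_ (·-zeroˡ x) (·-identityˡ x) (≤-· 𝟙 𝟘 x 0≤1)

  x+1≢0 : ∀ x → x + 𝟙 ≢ 𝟘
  x+1≢0 x eq = <⇒≱ 0<1 (subst₂ _≤_ (+-identityˡ 𝟙) eq (≤-+ x 𝟘 𝟙 (0≤x x)))

  ·-cancelʳ-< : ∀ {x y} z → y · z < x · z → y < x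
  ·-cancelʳ-< {x} {y} z yz<xz with ≤-total x y
  ... | inj₁ x≤y = ⊥-elim (<⇒≱ yz<xz (≤-· y x z x≤y))
  ... | inj₂ y≤x with ≤-discr x y y≤x
  ...   | inj₁ refl = ⊥-elim (<-irrefl yz<xz)
  ...   | inj₂ y<x = y<x

  m∣m·n : ∀ {m} n → m ∣ (m · n)
  m∣m·n {m} n = n , ·-comm n m

  [x+1]·2≡x·2+1+1 : ∀ x → (x + 𝟙) · 𝟚 ≡ x · 𝟚 + 𝟙 + 𝟙
  [x+1]·2≡x·2+1+1 x = begin
    (x + 𝟙) · 𝟚    ≡⟨ ·-distribʳ 𝟚 x 𝟙 ⟩
    x · 𝟚 + 𝟙 · 𝟚  ≡⟨ cong (x · 𝟚 +_) (·-identityˡ 𝟚) ⟩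
    x · 𝟚 + 𝟚      ≡⟨ +-assoc (x · 𝟚) 𝟙 𝟙 ⟨
    x · 𝟚 + 𝟙 + 𝟙  ∎

  even≢odd : ∀ w v → w · 𝟚 ≢ v · 𝟚 + 𝟙
  even≢odd w v eq = <-irrefl (subst (_≤ v · 𝟚 + 𝟙) ([x+1]·2≡x·2+1+1 v) [v+1]·2≤v·2+1)
    where
    v<w : v < w
    v<w = ·-cancelʳ-< 𝟚 (≤-reflexive (sym eq))

    [v+1]·2≤v·2+1 : (v + 𝟙) · 𝟚 ≤ v · 𝟚 + 𝟙
    [v+1]·2≤v·2+1 = subst ((v + 𝟙) · 𝟚 ≤_) eq (≤-· w (v + 𝟙) 𝟚 v<w)

  2y+3≡2y+1+1+1 : ∀ y → 𝟚 · y + 𝟛 ≡ 𝟚 · y + 𝟙 + 𝟙 + 𝟙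
  2y+3≡2y+1+1+1 y = begin
    𝟚 · y + (𝟙 + 𝟙 + 𝟙)  ≡⟨ +-assoc (𝟚 · y) (𝟙 + 𝟙) 𝟙 ⟨
    𝟚 · y + (𝟙 + 𝟙) + 𝟙  ≡⟨ cong (_+ 𝟙) (+-assoc (𝟚 · y) 𝟙 𝟙) ⟨
    𝟚 · y + 𝟙 + 𝟙 + 𝟙    ∎

  2y+3≡[y+1]·2+1 : ∀ y → 𝟚 · y + 𝟛 ≡ (y + 𝟙) · 𝟚 + 𝟙
  2y+3≡[y+1]·2+1 y = begin
    𝟚 · y + 𝟛              ≡⟨ 2y+3≡2y+1+1+1 y ⟩
    𝟚 · y + 𝟙 + 𝟙 + 𝟙      ≡⟨ cong (λ t → t + 𝟙 + 𝟙 + 𝟙) (·-comm 𝟚 y) ⟩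
    y · 𝟚 + 𝟙 + 𝟙 + 𝟙      ≡⟨ cong (_+ 𝟙) ([x+1]·2≡x·2+1+1 y) ⟨
    (y + 𝟙) · 𝟚 + 𝟙        ∎

  2y+3≢1 : ∀ y → 𝟚 · y + 𝟛 ≢ 𝟙
  2y+3≢1 y eq = x+1≢0 (𝟚 · y + 𝟙) (+-cancelʳ-≡ 𝟙 (begin
    𝟚 · y + 𝟙 + 𝟙 + 𝟙  ≡⟨ 2y+3≡2y+1+1+1 y ⟨
    𝟚 · y + 𝟛          ≡⟨ eq ⟩
    𝟙                  ≡⟨ +-identityˡ 𝟙 ⟨
    𝟘 + 𝟙              ∎))

  2∤2y+3 : ∀ y → ¬ 𝟚 ∣ (𝟚 · y + 𝟛)
  2∤2y+3 y (w , w·2≡2y+3) = even≢odd w (y + 𝟙) (trans w·2≡2y+3 (2y+3≡[y+1]·2+1 y))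

mainTheorem14 : {a ℓ : Level} (M : PAjer a ℓ) → let open Notions M in
    ∀ x → pow₂ x → pow₂tar x
mainTheorem14 M x pow₂x y z x≡[2y+3]z =
  [ 2y+3≢1 y , 2∤2y+3 y ] (pow₂x (𝟚 · y + 𝟛) 2y+3∣x)
  where
  open PAjer M
  open Notions M
  open Properties M

  2y+3∣x : (𝟚 · y + 𝟛) ∣ x
  2y+3∣x = subst ((𝟚 · y + 𝟛) ∣_) (sym x≡[2y+3]z) (m∣m·n z)
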